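{- Let $d\ge0$, $m=2^d$, and let $M=M_d^{n_1,\dots,n_m}$ for some admissible sequence $n_1,\dots,n_m$. Let $k$ be an integer with $1\le k\le 2^d$, and let $r,s\ge0$ be integers with $r+k\le m$ and $s+k\le m$ such that the entry $M_{r+1,s+k}$ lies in the upper border of $M$. Then the $k\times k$ submatrix of $M$ formed by the rows $r+1,\dots,r+k$ and the columns $s+1,\dots,s+k$ (whose top right entry is $M_{r+1,s+k}$) is invertible over $\mathbb{F}_2$.
   Context: Matrices over $\mathbb{F}_2$: $M_0=(1)$ and $M_{d+1}=\begin{pmatrix}M_d&M_d\\0&M_d\end{pmatrix}$, so $M_d$ is $2^d\times2^d$. Let $\sigma$ map a column vector $(a_1,\dots,a_n)^t$ to $(a_n,a_1,\dots,a_{n-1})^t$. A sequence of integers $n_1,\dots,n_m$ is admissible if $n_m=0$ and $n_{i+1}\le n_i\le n_{i+1}+1$ for $1\le i<m$. With $C_1,\dots,C_m$ the columns of $M_d$, $M_d^{n_1,\dots,n_m}$ is the matrix with columns $\sigma^{n_1}(C_1),\dots,\sigma^{n_m}(C_m)$. An entry $M_{i,j}$ is in the upper border of $M$ if $M_{i,j}=1$ and $M_{i',j}=0$ for all $1\le i'<i$ (i.e. it is the topmost entry equal to $1$ in column $j$). -}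

module Defs where

open import Data.Nat using (ℕ; zero; suc; _+_; _∸_; _^_; _≤_; _<_; _<ᵇ_)
open import Data.Nat.Properties using (_<?_)
open import Data.Fin using (Fin; zero; suc; toℕ; fromℕ; fromℕ<; inject₁)
open import Data.Bool using (Bool; true; false; _∧_; _xor_)
open import Data.Product using (Σ; _×_)
open import Relation.Nullary using (yes; no)
open import Relation.Binary.PropositionalEquality using (_≡_)

-- Matrices over F₂ (F₂ = Bool with xor as +, ∧ as ·), 0-based indices.
Mat : ℕ → ℕ → Set
Mat m n = Fin m → Fin n → Bool

-- Entries of M_d, indices as naturals (0-based), following the block recursion
-- M_{d+1} = [[M_d, M_d],[0, M_d]] with blocks of size 2^d.
mdℕ : ℕ → ℕ → ℕ → Bool
mdℕ zero i j = true
mdℕ (suc d) i j with i <ᵇ 2 ^ d | j <ᵇ 2 ^ d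
... | true  | true  = mdℕ d i j
... | true  | false = mdℕ d i (j ∸ 2 ^ d)
... | false | true  = false
... | false | false = mdℕ d (i ∸ 2 ^ d) (j ∸ 2 ^ d)

M : (d : ℕ) → Mat (2 ^ d) (2 ^ d)
M d i j = mdℕ d (toℕ i) (toℕ j)

σ : ∀ {n} → (Fin n → Bool) → Fin n → Bool
σ {suc n} v zero    = v (fromℕ n)
σ {suc n} v (suc i) = v (inject₁ i)

σ^ : ∀ {n} → ℕ → (Fin n → Bool) → Fin n → Bool
σ^ zero    v = v
σ^ (suc k) v = σ (σ^ k v)

-- Admissible sequence n₁,…,n_m (stored 0-based as a function on Fin m):
-- n_m = 0 and n_{i+1} ≤ n_i ≤ n_{i+1}+1.
Admissible : ∀ {m} → (Fin m → ℕ) → Set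
Admissible {m} n =
  (∀ (i : Fin m) → suc (toℕ i) ≡ m → n i ≡ 0) ×
  (∀ (i j : Fin m) → toℕ j ≡ suc (toℕ i) → (n j ≤ n i) × (n i ≤ suc (n j)))

Mshift : (d : ℕ) → (Fin (2 ^ d) → ℕ) → Mat (2 ^ d) (2 ^ d)
Mshift d n i j = σ^ (n j) (λ r → M d r j) i

-- Total entry lookup with natural-number (0-based) indices; false out of range.
at : ∀ {m n} → Mat m n → ℕ → ℕ → Bool
at {m} {n} A i j with i <? m | j <? n
... | yes p | yes q = A (fromℕ< p) (fromℕ< q)
... | _     | _     = false

UpperBorder : ∀ {m n} → Mat m n → ℕ → ℕ → Set
UpperBorder A i j = at A i j ≡ true × (∀ i' → i' < i → at A i' j ≡ false)

-- k×k submatrix with rows r+1..r+k and columns s+1..s+k (1-based)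
sub : ∀ {m n} → Mat m n → (k r s : ℕ) → Mat k k
sub A k r s a b = at A (r + toℕ a) (s + toℕ b)

sumF : ∀ {k} → (Fin k → Bool) → Bool
sumF {zero}  f = false
sumF {suc k} f = f zero xor sumF (λ i → f (suc i))

_·_ : ∀ {a b c} → Mat a b → Mat b c → Mat a c
(A · B) i j = sumF (λ l → A i l ∧ B l j)

I : ∀ {k} → Mat k k
I zero    zero    = true
I zero    (suc j) = false
I (suc i) zero    = false
I (suc i) (suc j) = I i j

Invertible : ∀ {k} → Mat k k → Set
Invertible {k} A = Σ (Mat k k) λ B →
  (∀ i j → (A · B) i j ≡ I i j) × (∀ i j → (B · A) i j ≡ I i j)

-- Index rows and columns from 0. Over F₂, column j of M_d holds the coefficients of (1 + x)^j:
-- the block recursion of M_d is the Frobenius identity (1 + x)^(2^d) = 1 + x^(2^d).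
-- Admissibility gives n_j + j < 2^d, so σ^(n_j) rotates only zeros past the end and column j
-- of M is x^(n_j) (1 + x)^j. Its upper border lies in row n_j, so the hypothesis says
-- n_(s+k-1) = r, and column b of the window is x^(t_b) (1 + x)^(s+b) truncated below degree k,
-- where t_b = n_(s+b) - r is again admissible with t_(k-1) = 0. Multiplication by 1 + x is
-- invertible on truncated series, which reduces the claim to s = 0. There t_(k-2) ≤ 1: if it is
-- 0 the last row of the window is a unit vector, if it is 1 every column but the last is
-- divisible by x and the first row is; expanding along that row leaves a window of the same
-- kind of size k - 1.
module Submission where

open import Defs
open import Algebra.Bundles using (CommutativeRing; CommutativeMonoid)
open import Data.Bool using (Bool; true; false; _∧_; _xor_)
open import Data.Bool.Properties
  using (xor-∧-commutativeRing; ∧-assoc; ∧-zeroʳ; ∧-identityʳ; ∧-distribʳ-xor;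
         xor-assoc; xor-same; xor-identityʳ)
open import Data.Fin using (Fin; zero; suc; toℕ; fromℕ; fromℕ<; inject₁; punchIn; punchOut)
open import Data.Fin.Properties
  using (_≟_; toℕ<n; toℕ-fromℕ; toℕ-fromℕ<; toℕ-inject₁; punchIn-injective; punchInᵢ≢i;
         punchIn-punchOut)
open import Data.Nat using (ℕ; zero; suc; _+_; _∸_; _^_; _≤_; _<_; _≮_; _<ᵇ_; z≤n; s≤s)
open import Data.Nat.Properties
  using (_<?_; _≤?_; <-cmp; ≤-refl; ≤-reflexive; ≤-trans; ≤-antisym; <-trans; <-≤-trans; <⇒≤;
         ≤-pred; ≰⇒>; ≮⇒≥; ≤⇒≯; n<1+n; m≤n⇒m≤1+n; <ᵇ-reflects-<;
         +-identityʳ; +-suc; +-comm; m≤m+n; m<m+n; +-monoˡ-≤; +-monoʳ-≤; +-monoʳ-<; +-cancelˡ-<;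
         n∸n≡0; m+[n∸m]≡n; m∸n+n≡m; m+n∸m≡n; ∸-monoˡ-≤; m≤n+o⇒m∸n≤o; m≤n+m∸n; m+n≤o⇒m≤o∸n)
open import Data.Product using (_×_; _,_; proj₁; proj₂)
open import Data.Vec.Functional using (insertAt)
open import Data.Vec.Functional.Properties using (insertAt-lookup; insertAt-punchIn)
open import Function using (_∘_)
open import Relation.Binary.Definitions using (tri<; tri≈; tri>)
open import Relation.Binary.PropositionalEquality
open import Relation.Nullary using (yes; no; contradiction)
open import Relation.Nullary.Reflects using (ofʸ; ofⁿ)
open ≡-Reasoning

open CommutativeRing xor-∧-commutativeRing using (semiring; +-commutativeMonoid)
open import Algebra.Properties.Semiring.Sum semiring
  using (sum-syntax; sum-cong-≗; sum-replicate-zero; sum-remove; ∑-comm; ∑-distrib-+;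
         *-distribˡ-sum; *-distribʳ-sum)
open import Algebra.Properties.CommutativeSemigroup
  (CommutativeMonoid.commutativeSemigroup +-commutativeMonoid) using (interchange)

infix 4 _≈_

_≈_ : ∀ {m n} → Mat m n → Mat m n → Set
A ≈ B = ∀ i j → A i j ≡ B i j

·-sum : ∀ {a b c} (A : Mat a b) (B : Mat b c) i j → (A · B) i j ≡ ∑[ l < b ] (A i l ∧ B l j)
·-sum {b = zero}  A B i j = refl
·-sum {b = suc b} A B i j = cong (A i zero ∧ B zero j xor_) (·-sum (λ i′ l → A i′ (suc l)) (λ l → B (suc l)) i j)

·-cong : ∀ {a b c} {A A′ : Mat a b} {B B′ : Mat b c} → A ≈ A′ → B ≈ B′ → (A · B) ≈ (A′ · B′)
·-cong {b = b} {A = A} {A′} {B} {B′} A≈A′ B≈B′ i j = begin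
  (A · B) i j                   ≡⟨ ·-sum A B i j ⟩
  ∑[ l < b ] (A i l ∧ B l j)     ≡⟨ sum-cong-≗ (λ l → cong₂ _∧_ (A≈A′ i l) (B≈B′ l j)) ⟩
  ∑[ l < b ] (A′ i l ∧ B′ l j)   ≡⟨ ·-sum A′ B′ i j ⟨
  (A′ · B′) i j                 ∎

·-congˡ : ∀ {a b c} {A A′ : Mat a b} (B : Mat b c) → A ≈ A′ → (A · B) ≈ (A′ · B)
·-congˡ B A≈A′ = ·-cong A≈A′ (λ _ _ → refl)

·-congʳ : ∀ {a b c} (A : Mat a b) {B B′ : Mat b c} → B ≈ B′ → (A · B) ≈ (A · B′)
·-congʳ A B≈B′ = ·-cong (λ _ _ → refl) B≈B′

·-assoc : ∀ {a b c e} (A : Mat a b) (B : Mat b c) (C : Mat c e) → ((A · B) · C) ≈ (A · (B · C))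
·-assoc {b = b} {c} A B C i j = begin
  ((A · B) · C) i j                                ≡⟨ ·-sum (A · B) C i j ⟩
  ∑[ l < c ] ((A · B) i l ∧ C l j)                  ≡⟨ sum-cong-≗ (λ l → cong (_∧ C l j) (·-sum A B i l)) ⟩
  ∑[ l < c ] (∑[ m < b ] (A i m ∧ B m l) ∧ C l j)   ≡⟨ sum-cong-≗ (λ l → *-distribʳ-sum (C l j) (λ m → A i m ∧ B m l)) ⟩
  ∑[ l < c ] ∑[ m < b ] ((A i m ∧ B m l) ∧ C l j)   ≡⟨ ∑-comm (λ l m → (A i m ∧ B m l) ∧ C l j) ⟩
  ∑[ m < b ] ∑[ l < c ] ((A i m ∧ B m l) ∧ C l j)   ≡⟨ sum-cong-≗ (λ m → sum-cong-≗ (λ l → ∧-assoc (A i m) (B m l) (C l j))) ⟩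
  ∑[ m < b ] ∑[ l < c ] (A i m ∧ (B m l ∧ C l j))   ≡⟨ sum-cong-≗ (λ m → *-distribˡ-sum (A i m) (λ l → B m l ∧ C l j)) ⟨
  ∑[ m < b ] (A i m ∧ ∑[ l < c ] (B m l ∧ C l j))   ≡⟨ sum-cong-≗ (λ m → cong (A i m ∧_) (·-sum B C m j)) ⟨
  ∑[ m < b ] (A i m ∧ (B · C) m j)                  ≡⟨ ·-sum A (B · C) i j ⟨
  (A · (B · C)) i j                                ∎

I-refl : ∀ {k} (i : Fin k) → I i i ≡ true
I-refl zero    = refl
I-refl (suc i) = I-refl i

I-≢ : ∀ {k} {i j : Fin k} → i ≢ j → I i j ≡ false
I-≢ {i = zero}  {zero}  i≢j = contradiction refl i≢j
I-≢ {i = zero}  {suc j} _   = refl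
I-≢ {i = suc i} {zero}  _   = refl
I-≢ {i = suc i} {suc j} i≢j = I-≢ (i≢j ∘ cong suc)

I-punchIn : ∀ {k} (p : Fin (suc k)) (i j : Fin k) → I (punchIn p i) (punchIn p j) ≡ I i j
I-punchIn p i j with i ≟ j
... | yes refl = trans (I-refl (punchIn p i)) (sym (I-refl i))
... | no i≢j   = trans (I-≢ (i≢j ∘ punchIn-injective p i j)) (sym (I-≢ i≢j))

I-punchInˡ : ∀ {k} (p : Fin (suc k)) (i : Fin k) → I (punchIn p i) p ≡ false
I-punchInˡ p i = I-≢ (punchInᵢ≢i p i)

I-punchInʳ : ∀ {k} (p : Fin (suc k)) (i : Fin k) → I p (punchIn p i) ≡ false
I-punchInʳ p i = I-≢ (punchInᵢ≢i p i ∘ sym)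

∑-δ : ∀ {k} (i : Fin k) (f : Fin k → Bool) → ∑[ l < k ] (I i l ∧ f l) ≡ f i
∑-δ {suc k} zero    f = trans (cong (f zero xor_) (sum-replicate-zero k)) (xor-identityʳ (f zero))
∑-δ         (suc i) f = ∑-δ i (f ∘ suc)

·-identityˡ : ∀ {m n} (A : Mat m n) → (I · A) ≈ A
·-identityˡ A i j = trans (·-sum I A i j) (∑-δ i (λ l → A l j))

·-cancel-inverse : ∀ {m n} {X Y : Mat m m} (W : Mat m n) → (X · Y) ≈ I → (X · (Y · W)) ≈ W
·-cancel-inverse {X = X} {Y} W XY≈I i j = begin
  (X · (Y · W)) i j  ≡⟨ ·-assoc X Y W i j ⟨
  ((X · Y) · W) i j  ≡⟨ ·-congˡ W XY≈I i j ⟩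
  (I · W) i j        ≡⟨ ·-identityˡ W i j ⟩
  W i j              ∎

invertible-resp-≈ : ∀ {k} {A A′ : Mat k k} → A ≈ A′ → Invertible A → Invertible A′
invertible-resp-≈ A≈A′ (B , AB≈I , BA≈I) =
  B , (λ i j → trans (·-congˡ B (λ i l → sym (A≈A′ i l)) i j) (AB≈I i j))
    , (λ i j → trans (·-congʳ B (λ l j → sym (A≈A′ l j)) i j) (BA≈I i j))

invertible-· : ∀ {k} {A B : Mat k k} → Invertible A → Invertible B → Invertible (A · B)
invertible-· {A = A} {B} (A⁻¹ , AA⁻¹≈I , A⁻¹A≈I) (B⁻¹ , BB⁻¹≈I , B⁻¹B≈I) =
  B⁻¹ · A⁻¹ , product-inverse A B B⁻¹ A⁻¹ BB⁻¹≈I AA⁻¹≈I , product-inverse B⁻¹ A⁻¹ A B A⁻¹A≈I B⁻¹B≈I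
  where
  product-inverse : ∀ X Y Y′ X′ → (Y · Y′) ≈ I → (X · X′) ≈ I → ((X · Y) · (Y′ · X′)) ≈ I
  product-inverse X Y Y′ X′ YY′≈I XX′≈I i j = begin
    ((X · Y) · (Y′ · X′)) i j  ≡⟨ ·-assoc X Y (Y′ · X′) i j ⟩
    (X · (Y · (Y′ · X′))) i j  ≡⟨ ·-congʳ X (·-cancel-inverse X′ YY′≈I) i j ⟩
    (X · X′) i j               ≡⟨ XX′≈I i j ⟩
    I i j                      ∎

invertible-empty : (A : Mat 0 0) → Invertible A
invertible-empty A = A , (λ ()) , (λ ())

-- Expansion along a unit row

data Punched {k} (p : Fin (suc k)) : Fin (suc k) → Set where
  here    : Punched p p
  punched : (j : Fin k) → Punched p (punchIn p j)

punched? : ∀ {k} (p j : Fin (suc k)) → Punched p j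
punched? p j with p ≟ j
... | yes refl = here
... | no p≢j   = subst (Punched p) (punchIn-punchOut p≢j) (punched (punchOut p≢j))

·-split : ∀ {a b k} (q : Fin (suc k)) (X : Mat a (suc k)) (Y : Mat (suc k) b) i j →
  (X · Y) i j ≡ X i q ∧ Y q j xor ∑[ l < k ] (X i (punchIn q l) ∧ Y (punchIn q l) j)
·-split q X Y i j = trans (·-sum X Y i j) (sum-remove {i = q} (λ l → X i l ∧ Y l j))

minor : ∀ {k} → Mat (suc k) (suc k) → Fin (suc k) → Fin (suc k) → Mat k k
minor A p q a b = A (punchIn p a) (punchIn q b)

-- B̂ is the block inverse of [[1, 0], [column, minor]], the shape A takes once row p and
-- column q are moved to the front; over F₂ the off-diagonal block B · column needs no sign.
module InverseFromMinor {k} (A : Mat (suc k) (suc k)) (p q : Fin (suc k)) (row : A p ≗ I q)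
                        (B : Mat k k) where

  column : Mat k 1
  column a _ = A (punchIn p a) q

  w : Fin k → Bool
  w i = (B · column) i zero

  B̂ : Mat (suc k) (suc k)
  B̂ = insertAt (λ i → insertAt (B i) p (w i)) q (I p)

  B̂-q : ∀ c → B̂ q c ≡ I p c
  B̂-q = cong-app (insertAt-lookup _ q (I p))

  B̂-punchIn : ∀ i c → B̂ (punchIn q i) c ≡ insertAt (B i) p (w i) c
  B̂-punchIn i = cong-app (insertAt-punchIn _ q (I p) i)

  row-punchIn : ∀ i → A p (punchIn q i) ≡ false
  row-punchIn i = trans (row _) (I-punchInʳ q i)

  rightInverse : (minor A p q · B) ≈ I → (A · B̂) ≈ I
  rightInverse AB≈I a c with punched? p a | punched? p c
  ... | here | _ = begin
    (A · B̂) p c                                                        ≡⟨ ·-split q A B̂ p c ⟩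
    A p q ∧ B̂ q c xor ∑[ i < k ] (A p (punchIn q i) ∧ B̂ (punchIn q i) c) ≡⟨ cong₂ _xor_ (cong₂ _∧_ (trans (row q) (I-refl q)) (B̂-q c))
                                                                           (trans (sum-cong-≗ (λ i → cong (_∧ B̂ (punchIn q i) c) (row-punchIn i)))
                                                                                  (sum-replicate-zero k)) ⟩
    I p c xor false                                                    ≡⟨ xor-identityʳ (I p c) ⟩
    I p c                                                              ∎
  ... | punched a′ | here = begin
    (A · B̂) (punchIn p a′) p                                 ≡⟨ ·-split q A B̂ _ p ⟩
    A (punchIn p a′) q ∧ B̂ q p xor ∑[ i < k ] (A (punchIn p a′) (punchIn q i) ∧ B̂ (punchIn q i) p)
                                                             ≡⟨ cong₂ _xor_ (cong (A (punchIn p a′) q ∧_) (trans (B̂-q p) (I-refl p)))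
                                                                  (sum-cong-≗ (λ i → cong (A (punchIn p a′) (punchIn q i) ∧_)
                                                                    (trans (B̂-punchIn i p) (insertAt-lookup (B i) p (w i))))) ⟩
    column a′ zero ∧ true xor ∑[ i < k ] (minor A p q a′ i ∧ (B · column) i zero)
                                                             ≡⟨ cong₂ _xor_ (∧-identityʳ (column a′ zero))
                                                                  (trans (sym (·-sum (minor A p q) (B · column) a′ zero))
                                                                         (·-cancel-inverse column AB≈I a′ zero)) ⟩
    column a′ zero xor column a′ zero                        ≡⟨ xor-same (column a′ zero) ⟩
    false                                                    ≡⟨ I-punchInˡ p a′ ⟨
    I (punchIn p a′) p                                       ∎
  ... | punched a′ | punched j = begin
    (A · B̂) (punchIn p a′) (punchIn p j)                      ≡⟨ ·-split q A B̂ _ _ ⟩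
    A (punchIn p a′) q ∧ B̂ q (punchIn p j) xor ∑[ i < k ] (A (punchIn p a′) (punchIn q i) ∧ B̂ (punchIn q i) (punchIn p j))
                                                             ≡⟨ cong₂ _xor_ (cong (A (punchIn p a′) q ∧_) (trans (B̂-q _) (I-punchInʳ p j)))
                                                                  (sum-cong-≗ (λ i → cong (A (punchIn p a′) (punchIn q i) ∧_)
                                                                    (trans (B̂-punchIn i _) (insertAt-punchIn (B i) p (w i) j)))) ⟩
    column a′ zero ∧ false xor ∑[ i < k ] (minor A p q a′ i ∧ B i j)
                                                             ≡⟨ cong₂ _xor_ (∧-zeroʳ (column a′ zero)) (sym (·-sum (minor A p q) B a′ j)) ⟩
    false xor (minor A p q · B) a′ j                         ≡⟨ AB≈I a′ j ⟩
    I a′ j                                                   ≡⟨ I-punchIn p a′ j ⟨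
    I (punchIn p a′) (punchIn p j)                           ∎

  leftInverse : (B · minor A p q) ≈ I → (B̂ · A) ≈ I
  leftInverse BA≈I c c′ with punched? q c | punched? q c′
  ... | here | _ = begin
    (B̂ · A) q c′                                                       ≡⟨ ·-split p B̂ A q c′ ⟩
    B̂ q p ∧ A p c′ xor ∑[ j < k ] (B̂ q (punchIn p j) ∧ A (punchIn p j) c′) ≡⟨ cong₂ _xor_ (cong₂ _∧_ (trans (B̂-q p) (I-refl p)) (row c′))
                                                                          (trans (sum-cong-≗ (λ j → cong (_∧ A (punchIn p j) c′)
                                                                                    (trans (B̂-q _) (I-punchInʳ p j))))
                                                                                 (sum-replicate-zero k)) ⟩
    I q c′ xor false                                                   ≡⟨ xor-identityʳ (I q c′) ⟩
    I q c′                                                             ∎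
  ... | punched i | here = begin
    (B̂ · A) (punchIn q i) q                                   ≡⟨ ·-split p B̂ A _ q ⟩
    B̂ (punchIn q i) p ∧ A p q xor ∑[ j < k ] (B̂ (punchIn q i) (punchIn p j) ∧ A (punchIn p j) q)
                                                             ≡⟨ cong₂ _xor_ (cong₂ _∧_ (trans (B̂-punchIn i p) (insertAt-lookup (B i) p (w i)))
                                                                                      (trans (row q) (I-refl q)))
                                                                  (sum-cong-≗ (λ j → cong (_∧ A (punchIn p j) q)
                                                                    (trans (B̂-punchIn i _) (insertAt-punchIn (B i) p (w i) j)))) ⟩
    w i ∧ true xor ∑[ j < k ] (B i j ∧ column j zero)        ≡⟨ cong₂ _xor_ (∧-identityʳ (w i)) (sym (·-sum B column i zero)) ⟩
    w i xor w i                                              ≡⟨ xor-same (w i) ⟩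
    false                                                    ≡⟨ I-punchInˡ q i ⟨
    I (punchIn q i) q                                        ∎
  ... | punched i | punched i′ = begin
    (B̂ · A) (punchIn q i) (punchIn q i′)                       ≡⟨ ·-split p B̂ A _ _ ⟩
    B̂ (punchIn q i) p ∧ A p (punchIn q i′) xor ∑[ j < k ] (B̂ (punchIn q i) (punchIn p j) ∧ A (punchIn p j) (punchIn q i′))
                                                             ≡⟨ cong₂ _xor_ (cong (B̂ (punchIn q i) p ∧_) (row-punchIn i′))
                                                                  (sum-cong-≗ (λ j → cong (_∧ A (punchIn p j) (punchIn q i′))
                                                                    (trans (B̂-punchIn i _) (insertAt-punchIn (B i) p (w i) j)))) ⟩
    B̂ (punchIn q i) p ∧ false xor ∑[ j < k ] (B i j ∧ minor A p q j i′)
                                                             ≡⟨ cong₂ _xor_ (∧-zeroʳ (B̂ (punchIn q i) p)) (sym (·-sum B (minor A p q) i i′)) ⟩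
    false xor (B · minor A p q) i i′                         ≡⟨ BA≈I i i′ ⟩
    I i i′                                                   ≡⟨ I-punchIn q i i′ ⟨
    I (punchIn q i) (punchIn q i′)                           ∎

invertible-from-minor : ∀ {k} (A : Mat (suc k) (suc k)) (p q : Fin (suc k)) →
  A p ≗ I q → Invertible (minor A p q) → Invertible A
invertible-from-minor A p q row (B , AB≈I , BA≈I) = B̂ , rightInverse AB≈I , leftInverse BA≈I
  where open InverseFromMinor A p q row B

-- Power series over F₂

Series : Set
Series = ℕ → Bool

one : Series
one zero    = true
one (suc _) = false

shift : Series → Series
shift f zero    = false
shift f (suc i) = f i

shift^ : ℕ → Series → Series
shift^ zero    f = f
shift^ (suc t) f = shift (shift^ t f)

infixl 6 _⊕_

_⊕_ : Series → Series → Series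
(f ⊕ g) i = f i xor g i

mul1+x : Series → Series
mul1+x f = f ⊕ shift f

pascal : ℕ → Series
pascal zero    = one
pascal (suc j) = mul1+x (pascal j)

shift-cong : ∀ {f g} → f ≗ g → shift f ≗ shift g
shift-cong f≗g zero    = refl
shift-cong f≗g (suc i) = f≗g i

shift^-cong : ∀ t {f g} → f ≗ g → shift^ t f ≗ shift^ t g
shift^-cong zero    f≗g = f≗g
shift^-cong (suc t) f≗g = shift-cong (shift^-cong t f≗g)

mul1+x-cong : ∀ {f g} → f ≗ g → mul1+x f ≗ mul1+x g
mul1+x-cong f≗g i = cong₂ _xor_ (f≗g i) (shift-cong f≗g i)

shift-⊕ : ∀ f g → shift (f ⊕ g) ≗ shift f ⊕ shift g
shift-⊕ f g zero    = refl
shift-⊕ f g (suc i) = refl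

shift^-⊕ : ∀ t f g → shift^ t (f ⊕ g) ≗ shift^ t f ⊕ shift^ t g
shift^-⊕ zero    f g i = refl
shift^-⊕ (suc t) f g i = trans (shift-cong (shift^-⊕ t f g) i) (shift-⊕ (shift^ t f) (shift^ t g) i)

mul1+x-⊕ : ∀ f g → mul1+x (f ⊕ g) ≗ mul1+x f ⊕ mul1+x g
mul1+x-⊕ f g i = trans (cong ((f i xor g i) xor_) (shift-⊕ f g i)) (interchange (f i) (g i) (shift f i) (shift g i))

shift^-+ : ∀ a b f → shift^ (a + b) f ≡ shift^ a (shift^ b f)
shift^-+ zero    b f = refl
shift^-+ (suc a) b f = cong shift (shift^-+ a b f)

shift^-shift : ∀ t f → shift^ t (shift f) ≡ shift (shift^ t f)
shift^-shift t f = begin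
  shift^ t (shift^ 1 f)  ≡⟨ shift^-+ t 1 f ⟨
  shift^ (t + 1) f       ≡⟨ cong (λ u → shift^ u f) (+-comm t 1) ⟩
  shift^ (suc t) f       ∎

shift^-mul1+x : ∀ t f → shift^ t (mul1+x f) ≗ mul1+x (shift^ t f)
shift^-mul1+x t f i = trans (shift^-⊕ t f (shift f) i) (cong (shift^ t f i xor_) (cong-app (shift^-shift t f) i))

shift^-< : ∀ {t i} f → i < t → shift^ t f i ≡ false
shift^-< {suc t} {zero}  f _         = refl
shift^-< {suc t} {suc i} f (s≤s i<t) = shift^-< f i<t

shift^-+-lookup : ∀ t f i → shift^ t f (t + i) ≡ f i
shift^-+-lookup zero    f i = refl
shift^-+-lookup (suc t) f i = shift^-+-lookup t f i

shift^-≥ : ∀ {t i} f → t ≤ i → shift^ t f i ≡ f (i ∸ t)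
shift^-≥ {t} {i} f t≤i = trans (cong (shift^ t f) (sym (m+[n∸m]≡n t≤i))) (shift^-+-lookup t f (i ∸ t))

shift^-suc-lookup : ∀ {t} f i → 1 ≤ t → shift^ t f (suc i) ≡ shift^ (t ∸ 1) f i
shift^-suc-lookup {suc t} f i _ = refl

pascal-above : ∀ {j i} → j < i → pascal j i ≡ false
pascal-above {zero}  {suc i} _         = refl
pascal-above {suc j} {suc i} (s≤s j<i) = cong₂ _xor_ (pascal-above (s≤s (<⇒≤ j<i))) (pascal-above j<i)

pascal-zero : ∀ j → pascal j 0 ≡ true
pascal-zero zero    = refl
pascal-zero (suc j) = trans (xor-identityʳ (pascal j 0)) (pascal-zero j)

pascal-diag : ∀ j → pascal j j ≡ true
pascal-diag zero    = refl
pascal-diag (suc j) = cong₂ _xor_ (pascal-above {j} (s≤s ≤-refl)) (pascal-diag j)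

shift^-pascal-above : ∀ {t j i} → t + j < i → shift^ t (pascal j) i ≡ false
shift^-pascal-above {t} {j} {i} t+j<i = trans (shift^-≥ (pascal j) t≤i) (pascal-above j<i∸t)
  where
  t≤i : t ≤ i
  t≤i = ≤-trans (m≤m+n t j) (<⇒≤ t+j<i)
  j<i∸t : j < i ∸ t
  j<i∸t = m+n≤o⇒m≤o∸n (suc j) (subst (_≤ i) (cong suc (+-comm t j)) t+j<i)

pascal-+ : ∀ h → pascal h ≗ one ⊕ shift^ h one → ∀ j → pascal (h + j) ≗ pascal j ⊕ shift^ h (pascal j)
pascal-+ h pascal-h zero    i rewrite +-identityʳ h = pascal-h i
pascal-+ h pascal-h (suc j) i rewrite +-suc h j = begin
  mul1+x (pascal (h + j)) i                             ≡⟨ mul1+x-cong (pascal-+ h pascal-h j) i ⟩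
  mul1+x (pascal j ⊕ shift^ h (pascal j)) i             ≡⟨ mul1+x-⊕ (pascal j) (shift^ h (pascal j)) i ⟩
  (mul1+x (pascal j) ⊕ mul1+x (shift^ h (pascal j))) i  ≡⟨ cong (pascal (suc j) i xor_) (shift^-mul1+x h (pascal j) i) ⟨
  (pascal (suc j) ⊕ shift^ h (pascal (suc j))) i        ∎

pascal-2^ : ∀ d → pascal (2 ^ d) ≗ one ⊕ shift^ (2 ^ d) one
pascal-2^ zero    i = refl
pascal-2^ (suc d) i rewrite +-identityʳ (2 ^ d) = begin
  pascal (h + h) i                                      ≡⟨ pascal-+ h (pascal-2^ d) h i ⟩
  pascal h i xor shift^ h (pascal h) i                  ≡⟨ cong₂ _xor_ (pascal-2^ d i) (shift^-cong h (pascal-2^ d) i) ⟩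
  (one i xor x^h i) xor shift^ h (one ⊕ shift^ h one) i ≡⟨ cong ((one i xor x^h i) xor_) (shift^-⊕ h one (shift^ h one) i) ⟩
  (one i xor x^h i) xor (x^h i xor x^2h i)              ≡⟨ xor-assoc (one i) (x^h i) _ ⟩
  one i xor (x^h i xor (x^h i xor x^2h i))              ≡⟨ cong (one i xor_) (xor-assoc (x^h i) (x^h i) _) ⟨
  one i xor ((x^h i xor x^h i) xor x^2h i)              ≡⟨ cong (λ b → one i xor (b xor x^2h i)) (xor-same (x^h i)) ⟩
  one i xor x^2h i                                      ≡⟨ cong (λ g → one i xor g i) (shift^-+ h h one) ⟨
  one i xor shift^ (h + h) one i                        ∎
  where
  h = 2 ^ d
  x^h = shift^ h one
  x^2h = shift^ h (shift^ h one)

-- Matrices of truncated series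

columns : ∀ k → (ℕ → Series) → Mat k k
columns k F a b = F (toℕ b) (toℕ a)

subdiagonal : ∀ {k} → Mat k k
subdiagonal zero    c = false
subdiagonal (suc a) c = I (inject₁ a) c

subdiagonal-suc : ∀ {k} (a b : Fin k) → subdiagonal (suc a) (suc b) ≡ subdiagonal a b
subdiagonal-suc zero    b = refl
subdiagonal-suc (suc a) b = refl

subdiagonal-columns : ∀ k F → (subdiagonal · columns k F) ≈ columns k (shift ∘ F)
subdiagonal-columns k       F zero    b = trans (·-sum subdiagonal (columns k F) zero b) (sum-replicate-zero k)
subdiagonal-columns (suc k) F (suc a) b = begin
  (subdiagonal · columns (suc k) F) (suc a) b          ≡⟨ ·-sum subdiagonal (columns (suc k) F) (suc a) b ⟩
  ∑[ l < suc k ] (I (inject₁ a) l ∧ F (toℕ b) (toℕ l))  ≡⟨ ∑-δ (inject₁ a) (λ l → F (toℕ b) (toℕ l)) ⟩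
  F (toℕ b) (toℕ (inject₁ a))                          ≡⟨ cong (F (toℕ b)) (toℕ-inject₁ a) ⟩
  F (toℕ b) (toℕ a)                                    ∎

-- The matrix of multiplication by 1 + x on series truncated below degree k.
unipotentBidiagonal : ∀ {k} → Mat k k
unipotentBidiagonal a c = I a c xor subdiagonal a c

unipotentBidiagonal-columns : ∀ k F → (unipotentBidiagonal · columns k F) ≈ columns k (mul1+x ∘ F)
unipotentBidiagonal-columns k F a b = begin
  (unipotentBidiagonal · C) a b                                       ≡⟨ ·-sum unipotentBidiagonal C a b ⟩
  ∑[ l < k ] ((I a l xor subdiagonal a l) ∧ C l b)                    ≡⟨ sum-cong-≗ (λ l → ∧-distribʳ-xor (C l b) (I a l) (subdiagonal a l)) ⟩
  ∑[ l < k ] ((I a l ∧ C l b) xor (subdiagonal a l ∧ C l b))          ≡⟨ ∑-distrib-+ (λ l → I a l ∧ C l b) (λ l → subdiagonal a l ∧ C l b) ⟩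
  ∑[ l < k ] (I a l ∧ C l b) xor ∑[ l < k ] (subdiagonal a l ∧ C l b) ≡⟨ cong₂ _xor_ (sym (·-sum I C a b)) (sym (·-sum subdiagonal C a b)) ⟩
  (I · C) a b xor (subdiagonal · C) a b                               ≡⟨ cong₂ _xor_ (·-identityˡ C a b) (subdiagonal-columns k F a b) ⟩
  mul1+x (F (toℕ b)) (toℕ a)                                          ∎
  where C = columns k F

unipotentBidiagonal-invertible : ∀ k → Invertible (unipotentBidiagonal {k})
unipotentBidiagonal-invertible zero    = invertible-empty unipotentBidiagonal
unipotentBidiagonal-invertible (suc k) =
  invertible-from-minor unipotentBidiagonal zero zero (λ c → xor-identityʳ (I zero c))
    (invertible-resp-≈ (λ a b → cong (I a b xor_) (sym (subdiagonal-suc a b))) (unipotentBidiagonal-invertible k))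

pascalShifts : ∀ k → ℕ → (ℕ → ℕ) → Mat k k
pascalShifts k s t = columns k (λ b → shift^ (t b) (pascal (s + b)))

pascalShifts-suc : ∀ k s t → (unipotentBidiagonal · pascalShifts k s t) ≈ pascalShifts k (suc s) t
pascalShifts-suc k s t a b =
  trans (unipotentBidiagonal-columns k (λ b → shift^ (t b) (pascal (s + b))) a b)
        (sym (shift^-mul1+x (t (toℕ b)) (pascal (s + toℕ b)) (toℕ a)))

-- The admissibility condition, imposed at every position of ℕ.
Staircase : (ℕ → ℕ) → Set
Staircase t = ∀ b → t (suc b) ≤ t b × t b ≤ suc (t (suc b))

module _ {t : ℕ → ℕ} (staircase : Staircase t) where

  staircase-antitone : ∀ {b b′} → b ≤ b′ → t b′ ≤ t b
  staircase-antitone {b} b≤b′ = subst (λ u → t u ≤ t b) (m+[n∸m]≡n b≤b′) (descend (_ ∸ b))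
    where
    descend : ∀ e → t (b + e) ≤ t b
    descend zero    rewrite +-identityʳ b = ≤-refl
    descend (suc e) rewrite +-suc b e = ≤-trans (proj₁ (staircase (b + e))) (descend e)

  staircase-lipschitz : ∀ {b b′} → b ≤ b′ → t b ≤ t b′ + (b′ ∸ b)
  staircase-lipschitz {b} {b′} b≤b′ = subst (λ u → t b ≤ t u + (b′ ∸ b)) (m+[n∸m]≡n b≤b′) (climb (b′ ∸ b))
    where
    climb : ∀ e → t b ≤ t (b + e) + e
    climb zero    rewrite +-identityʳ b | +-identityʳ (t b) = ≤-refl
    climb (suc e) rewrite +-suc b e | +-suc (t (suc (b + e))) e =
      ≤-trans (climb e) (+-monoˡ-≤ e (proj₂ (staircase (b + e))))

  staircase-∸ : ∀ r → Staircase (λ b → t b ∸ r)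
  staircase-∸ r b = ∸-monoˡ-≤ r (proj₁ (staircase b)) , ∸-suc-≤ (proj₂ (staircase b))
    where
    ∸-suc-≤ : ∀ {x y} → x ≤ suc y → x ∸ r ≤ suc (y ∸ r)
    ∸-suc-≤ {x} {y} x≤1+y =
      m≤n+o⇒m∸n≤o x r (≤-trans x≤1+y (≤-trans (s≤s (m≤n+m∸n y r)) (≤-reflexive (sym (+-suc r (y ∸ r))))))

  staircase-drop : ∀ s → Staircase (λ b → t (s + b))
  staircase-drop s b rewrite +-suc s b = staircase (s + b)

toℕ-punchIn-fromℕ : ∀ {k} (a : Fin k) → toℕ (punchIn (fromℕ k) a) ≡ toℕ a
toℕ-punchIn-fromℕ zero    = refl
toℕ-punchIn-fromℕ (suc a) = cong suc (toℕ-punchIn-fromℕ a)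

module _ {k} (t : ℕ → ℕ) (t[k]≡0 : t k ≡ 0) where

  expand-lastRow : (∀ b → b < k → t b + b < k) →
    Invertible (pascalShifts k 0 t) → Invertible (pascalShifts (suc k) 0 t)
  expand-lastRow low = invertible-from-minor A (fromℕ k) (fromℕ k) lastRow ∘ invertible-resp-≈ minor≈
    where
    A = pascalShifts (suc k) 0 t
    lastRow : A (fromℕ k) ≗ I (fromℕ k)
    lastRow c with punched? (fromℕ k) c
    ... | here rewrite toℕ-fromℕ k | t[k]≡0 = trans (pascal-diag k) (sym (I-refl (fromℕ k)))
    ... | punched c′ rewrite toℕ-fromℕ k | toℕ-punchIn-fromℕ c′ =
      trans (shift^-pascal-above {t (toℕ c′)} {toℕ c′} (low _ (toℕ<n c′))) (sym (I-punchInʳ (fromℕ k) c′))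
    minor≈ : pascalShifts k 0 t ≈ minor A (fromℕ k) (fromℕ k)
    minor≈ a b rewrite toℕ-punchIn-fromℕ a | toℕ-punchIn-fromℕ b = refl

  expand-firstRow : (∀ b → b < k → 1 ≤ t b) →
    Invertible (pascalShifts k 0 (λ b → t b ∸ 1)) → Invertible (pascalShifts (suc k) 0 t)
  expand-firstRow positive = invertible-from-minor A zero (fromℕ k) firstRow ∘ invertible-resp-≈ minor≈
    where
    A = pascalShifts (suc k) 0 t
    firstRow : A zero ≗ I (fromℕ k)
    firstRow c with punched? (fromℕ k) c
    ... | here rewrite toℕ-fromℕ k | t[k]≡0 = trans (pascal-zero k) (sym (I-refl (fromℕ k)))
    ... | punched c′ rewrite toℕ-punchIn-fromℕ c′ =
      trans (shift^-< _ (positive _ (toℕ<n c′))) (sym (I-punchInʳ (fromℕ k) c′))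
    minor≈ : pascalShifts k 0 (λ b → t b ∸ 1) ≈ minor A zero (fromℕ k)
    minor≈ a b rewrite toℕ-punchIn-fromℕ b =
      sym (shift^-suc-lookup (pascal (toℕ b)) (toℕ a) (positive _ (toℕ<n b)))

pascalShifts₀-invertible : ∀ k t → Staircase t → t k ≡ 0 → Invertible (pascalShifts (suc k) 0 t)
pascalShifts₀-invertible zero t _ t[0]≡0 =
  expand-lastRow t t[0]≡0 (λ _ ()) (invertible-empty (pascalShifts 0 0 t))
pascalShifts₀-invertible (suc k) t staircase t[1+k]≡0
  with t k in t[k]≡ | subst (λ u → t k ≤ suc u) t[1+k]≡0 (proj₂ (staircase k))
... | zero | _ = expand-lastRow t t[1+k]≡0 low (pascalShifts₀-invertible k t staircase t[k]≡)
  where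
  low : ∀ b → b < suc k → t b + b < suc k
  low b b<1+k = s≤s (≤-trans (+-monoˡ-≤ b (staircase-lipschitz staircase b≤k))
                              (≤-reflexive (trans (cong (λ u → u + (k ∸ b) + b) t[k]≡) (m∸n+n≡m b≤k))))
    where b≤k = ≤-pred b<1+k
... | suc zero | _ = expand-firstRow t t[1+k]≡0 positive
      (pascalShifts₀-invertible k (λ b → t b ∸ 1) (staircase-∸ staircase 1) (cong (_∸ 1) t[k]≡))
  where
  positive : ∀ b → b < suc k → 1 ≤ t b
  positive b b<1+k = subst (_≤ t b) t[k]≡ (staircase-antitone staircase (≤-pred b<1+k))
... | suc (suc _) | s≤s ()

pascalShifts-invertible : ∀ s k t → Staircase t → t k ≡ 0 → Invertible (pascalShifts (suc k) s t)
pascalShifts-invertible zero    k t staircase t[k]≡0 = pascalShifts₀-invertible k t staircase t[k]≡0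
pascalShifts-invertible (suc s) k t staircase t[k]≡0 =
  invertible-resp-≈ (pascalShifts-suc (suc k) s t)
    (invertible-· {A = unipotentBidiagonal} {B = pascalShifts (suc k) s t}
      (unipotentBidiagonal-invertible (suc k)) (pascalShifts-invertible s k t staircase t[k]≡0))

-- The matrices M_d and M_d^{n₁,…,n_m}

upperHalf-∸ : ∀ {h j} → j ≮ h → j < h + h → j ∸ h < h
upperHalf-∸ {h} {j} j≮h j<2h = +-cancelˡ-< h (j ∸ h) h (subst (_< h + h) (sym (m+[n∸m]≡n (≮⇒≥ j≮h))) j<2h)

pascal-2^-+ : ∀ d {i j} → 2 ^ d ≤ j →
  pascal j i ≡ pascal (j ∸ 2 ^ d) i xor shift^ (2 ^ d) (pascal (j ∸ 2 ^ d)) i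
pascal-2^-+ d {i} {j} h≤j =
  trans (cong (λ u → pascal u i) (sym (m+[n∸m]≡n h≤j))) (pascal-+ (2 ^ d) (pascal-2^ d) (j ∸ 2 ^ d) i)

M-pascal : ∀ d {i j} → i < 2 ^ d → j < 2 ^ d → mdℕ d i j ≡ pascal j i
M-pascal zero    {zero}  {zero}  _        _        = refl
M-pascal zero    {suc i}         (s≤s ()) _
M-pascal zero    {zero}  {suc j} _        (s≤s ())
M-pascal (suc d) {i} {j} i<2h j<2h rewrite +-identityʳ (2 ^ d)
  with i <ᵇ 2 ^ d | <ᵇ-reflects-< i (2 ^ d) | j <ᵇ 2 ^ d | <ᵇ-reflects-< j (2 ^ d)
... | true  | ofʸ i<h | true  | ofʸ j<h = M-pascal d i<h j<h
... | true  | ofʸ i<h | false | ofⁿ j≮h = begin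
  mdℕ d i (j ∸ h)                                     ≡⟨ M-pascal d i<h (upperHalf-∸ j≮h j<2h) ⟩
  pascal (j ∸ h) i                                    ≡⟨ xor-identityʳ _ ⟨
  pascal (j ∸ h) i xor false                          ≡⟨ cong (pascal (j ∸ h) i xor_) (shift^-< (pascal (j ∸ h)) i<h) ⟨
  pascal (j ∸ h) i xor shift^ h (pascal (j ∸ h)) i    ≡⟨ pascal-2^-+ d (≮⇒≥ j≮h) ⟨
  pascal j i                                          ∎
  where h = 2 ^ d
... | false | ofⁿ i≮h | true  | ofʸ j<h = sym (pascal-above (<-≤-trans j<h (≮⇒≥ i≮h)))
... | false | ofⁿ i≮h | false | ofⁿ j≮h = begin
  mdℕ d (i ∸ h) (j ∸ h)                               ≡⟨ M-pascal d (upperHalf-∸ i≮h i<2h) (upperHalf-∸ j≮h j<2h) ⟩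
  pascal (j ∸ h) (i ∸ h)                              ≡⟨ shift^-≥ (pascal (j ∸ h)) (≮⇒≥ i≮h) ⟨
  shift^ h (pascal (j ∸ h)) i                         ≡⟨ cong (_xor shift^ h (pascal (j ∸ h)) i)
                                                           (pascal-above (<-≤-trans (upperHalf-∸ j≮h j<2h) (≮⇒≥ i≮h))) ⟨
  pascal (j ∸ h) i xor shift^ h (pascal (j ∸ h)) i    ≡⟨ pascal-2^-+ d (≮⇒≥ j≮h) ⟨
  pascal j i                                          ∎
  where h = 2 ^ d

at-fromℕ< : ∀ {m n} (A : Mat m n) {i j} (i<m : i < m) (j<n : j < n) → at A i j ≡ A (fromℕ< i<m) (fromℕ< j<n)
at-fromℕ< {m} {n} A {i} {j} i<m j<n with i <? m | j <? n
... | yes _  | yes _  = refl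
... | no i≮m | _      = contradiction i<m i≮m
... | yes _  | no j≮n = contradiction j<n j≮n

σ^-shift^ : ∀ {m} t {v : Fin m → Bool} {f : Series} → v ≗ f ∘ toℕ →
  (∀ i → m ≤ t + i → f i ≡ false) → σ^ t v ≗ shift^ t f ∘ toℕ
σ^-shift^ zero v≗f _ = v≗f
σ^-shift^ {suc m} (suc t) {v} {f} v≗f vanish zero = begin
  σ^ t v (fromℕ m)            ≡⟨ σ^-shift^ t v≗f (λ i → vanish i ∘ m≤n⇒m≤1+n) (fromℕ m) ⟩
  shift^ t f (toℕ (fromℕ m))  ≡⟨ cong (shift^ t f) (toℕ-fromℕ m) ⟩
  shift^ t f m                ≡⟨ wrapped ⟩
  false                       ∎
  where
  wrapped : shift^ t f m ≡ false
  wrapped with m <? t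
  ... | yes m<t = shift^-< f m<t
  ... | no m≮t  = trans (shift^-≥ f (≮⇒≥ m≮t)) (vanish (m ∸ t) (s≤s (≤-reflexive (sym (m+[n∸m]≡n (≮⇒≥ m≮t))))))
σ^-shift^ {suc m} (suc t) {v} {f} v≗f vanish (suc i) =
  trans (σ^-shift^ t v≗f (λ i → vanish i ∘ m≤n⇒m≤1+n) (inject₁ i)) (cong (shift^ t f) (toℕ-inject₁ i))

-- The shift sequence, continued by 0 past its last index so that it stays a staircase.
extend : ∀ {m} → (Fin m → ℕ) → ℕ → ℕ
extend {m} n j with j <? m
... | yes j<m = n (fromℕ< j<m)
... | no  _   = 0

extend-fromℕ< : ∀ {m} (n : Fin m → ℕ) {j} (j<m : j < m) → extend n j ≡ n (fromℕ< j<m)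
extend-fromℕ< {m} n {j} j<m with j <? m
... | yes _  = refl
... | no j≮m = contradiction j<m j≮m

extend-≥ : ∀ {m} (n : Fin m → ℕ) {j} → m ≤ j → extend n j ≡ 0
extend-≥ {m} n {j} m≤j with j <? m
... | yes j<m = contradiction j<m (≤⇒≯ m≤j)
... | no _    = refl

module _ {m} {n : Fin m → ℕ} (admissible : Admissible n) where

  extend-last : ∀ {b} → m ≤ suc b → extend n b ≡ 0
  extend-last {b} m≤1+b with m ≤? b
  ... | yes m≤b = extend-≥ n m≤b
  ... | no m≰b  = trans (extend-fromℕ< n b<m)
                    (proj₁ admissible (fromℕ< b<m) (trans (cong suc (toℕ-fromℕ< b<m)) (≤-antisym b<m m≤1+b)))
    where b<m = ≰⇒> m≰b

  extend-staircase : Staircase (extend n)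
  extend-staircase b with m ≤? suc b
  ... | yes m≤1+b rewrite extend-≥ n m≤1+b | extend-last m≤1+b = z≤n , z≤n
  ... | no m≰1+b =
    subst₂ (λ x y → x ≤ y × y ≤ suc x) (sym (extend-fromℕ< n 1+b<m)) (sym (extend-fromℕ< n b<m))
      (proj₂ admissible (fromℕ< b<m) (fromℕ< 1+b<m) (trans (toℕ-fromℕ< 1+b<m) (cong suc (sym (toℕ-fromℕ< b<m)))))
    where
    1+b<m = ≰⇒> m≰1+b
    b<m = <-trans (n<1+n b) 1+b<m

  extend-bound : ∀ {j} → j < m → extend n j + j < m
  extend-bound {j} j<m = subst (extend n j + j <_) 1+j+e≡m (s≤s (≤-trans
    (+-monoˡ-≤ j (staircase-lipschitz extend-staircase (m≤m+n j e)))
    (≤-reflexive (trans (cong₂ (λ x y → x + y + j) (extend-last (≤-reflexive (sym 1+j+e≡m))) (m+n∸m≡n j e))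
                        (+-comm e j)))))
    where
    e = m ∸ suc j
    1+j+e≡m : suc (j + e) ≡ m
    1+j+e≡m = m+[n∸m]≡n j<m

module _ {d} {n : Fin (2 ^ d) → ℕ} (admissible : Admissible n) where

  Mshift-entry : ∀ {i j} → i < 2 ^ d → j < 2 ^ d → at (Mshift d n) i j ≡ shift^ (extend n j) (pascal j) i
  Mshift-entry {i} {j} i<m j<m = begin
    at (Mshift d n) i j                     ≡⟨ at-fromℕ< (Mshift d n) i<m j<m ⟩
    σ^ t column (fromℕ< i<m)                ≡⟨ σ^-shift^ t column≗pascal vanish (fromℕ< i<m) ⟩
    shift^ t (pascal j) (toℕ (fromℕ< i<m))  ≡⟨ cong₂ (λ u v → shift^ u (pascal j) v) (sym (extend-fromℕ< n j<m)) (toℕ-fromℕ< i<m) ⟩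
    shift^ (extend n j) (pascal j) i        ∎
    where
    t = n (fromℕ< j<m)
    column : Fin (2 ^ d) → Bool
    column r = M d r (fromℕ< j<m)
    column≗pascal : column ≗ pascal j ∘ toℕ
    column≗pascal r = trans (cong (mdℕ d (toℕ r)) (toℕ-fromℕ< j<m)) (M-pascal d (toℕ<n r) j<m)
    vanish : ∀ i → 2 ^ d ≤ t + i → pascal j i ≡ false
    vanish i m≤t+i = pascal-above (+-cancelˡ-< t j i (<-≤-trans t+j<m m≤t+i))
      where t+j<m = subst (λ u → u + j < 2 ^ d) (extend-fromℕ< n j<m) (extend-bound admissible j<m)

  upperBorder⇒extend≡ : ∀ {i j} → i < 2 ^ d → j < 2 ^ d → UpperBorder (Mshift d n) i j → extend n j ≡ i
  upperBorder⇒extend≡ {i} {j} i<m j<m (isOne , zerosAbove) with <-cmp (extend n j) i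
  ... | tri≈ _ t≡i _ = t≡i
  ... | tri< t<i _ _ =
    contradiction (trans (sym (zerosAbove t t<i)) (trans (Mshift-entry (<-trans t<i i<m) j<m) lowest)) λ ()
    where
    t = extend n j
    lowest : shift^ t (pascal j) t ≡ true
    lowest = trans (cong (shift^ t (pascal j)) (sym (+-identityʳ t))) (trans (shift^-+-lookup t (pascal j) 0) (pascal-zero j))
  ... | tri> _ _ t>i =
    contradiction (trans (sym isOne) (trans (Mshift-entry i<m j<m) (shift^-< (pascal j) t>i))) λ ()

  sub-Mshift≈pascalShifts : ∀ {k r s} → r + k ≤ 2 ^ d → s + k ≤ 2 ^ d → (∀ b → b < k → r ≤ extend n (s + b)) →
    sub (Mshift d n) k r s ≈ pascalShifts k s (λ b → extend n (s + b) ∸ r)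
  sub-Mshift≈pascalShifts {k} {r} {s} r+k≤m s+k≤m r≤ a b = begin
    at (Mshift d n) (r + toℕ a) (s + toℕ b)    ≡⟨ Mshift-entry (<-≤-trans (+-monoʳ-< r (toℕ<n a)) r+k≤m)
                                                                (<-≤-trans (+-monoʳ-< s (toℕ<n b)) s+k≤m) ⟩
    shift^ (extend n c) (pascal c) (r + toℕ a)  ≡⟨ cong (λ u → shift^ u (pascal c) (r + toℕ a)) (sym (m+[n∸m]≡n (r≤ (toℕ b) (toℕ<n b)))) ⟩
    shift^ (r + τ) (pascal c) (r + toℕ a)       ≡⟨ cong-app (shift^-+ r τ (pascal c)) (r + toℕ a) ⟩
    shift^ r (shift^ τ (pascal c)) (r + toℕ a)  ≡⟨ shift^-+-lookup r (shift^ τ (pascal c)) (toℕ a) ⟩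
    shift^ τ (pascal c) (toℕ a)                 ∎
    where
    c = s + toℕ b
    τ = extend n c ∸ r

lemma5 : (d : ℕ) (n : Fin (2 ^ d) → ℕ) → Admissible n →
    (k r s : ℕ) → 1 ≤ k → k ≤ 2 ^ d → r + k ≤ 2 ^ d → s + k ≤ 2 ^ d →
    UpperBorder (Mshift d n) r (s + k ∸ 1) →
    Invertible (sub (Mshift d n) k r s)
lemma5 d n admissible (suc k) r s _ _ r+k≤m s+k≤m border =
  invertible-resp-≈ (λ a b → sym (window a b)) (pascalShifts-invertible s k τ τ-staircase τ[k]≡0)
  where
  staircase = extend-staircase admissible
  last≡r : extend n (s + k) ≡ r
  last≡r = upperBorder⇒extend≡ {d} admissible (<-≤-trans (m<m+n r (s≤s z≤n)) r+k≤m)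
             (<-≤-trans (+-monoʳ-< s (n<1+n k)) s+k≤m)
             (subst (UpperBorder (Mshift d n) r) (cong (_∸ 1) (+-suc s k)) border)
  τ : ℕ → ℕ
  τ b = extend n (s + b) ∸ r
  τ-staircase : Staircase τ
  τ-staircase = staircase-∸ (staircase-drop staircase s) r
  τ[k]≡0 : τ k ≡ 0
  τ[k]≡0 = trans (cong (_∸ r) last≡r) (n∸n≡0 r)
  window : sub (Mshift d n) (suc k) r s ≈ pascalShifts (suc k) s τ
  window = sub-Mshift≈pascalShifts {d} admissible r+k≤m s+k≤m λ b b<1+k →
    subst (_≤ extend n (s + b)) last≡r (staircase-antitone staircase (+-monoʳ-≤ s (≤-pred b<1+k)))
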